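{- For any Epstein model $\mathfrak{M}=\langle v,\mathfrak{R}\rangle$, $\mathsf{S}^{\mathsf{Th}(\mathfrak{M})}=\{\mathfrak{N}\in\mathsf{M}:\mathsf{Th}(\mathfrak{M})=\mathsf{Th}(\mathfrak{N})\}$.
   Context: Let $\Phi=\{p_0,p_1,\dots\}$ be a countably infinite set of propositional letters; $\mathsf{FOR}$ is the set of formulas built from $\Phi$ with $\neg$ and binary $\lor,\wedge,\to,\leftrightarrow,\vartriangle,\looparrowright$. An Epstein model is $\langle v,\mathfrak{R}\rangle$ with $v:\Phi\to\{0,1\}$ and $\mathfrak{R}\subseteq\mathsf{FOR}^2$; $\mathsf{M}$ is the set of all Epstein models. Truth: $\langle v,\mathfrak{R}\rangle\vDash p$ iff $v(p)=1$; classical clauses for $\neg,\wedge,\lor,\to,\leftrightarrow$; $\vDash\psi\vartriangle\chi$ iff both $\psi,\chi$ true and $\langle\psi,\chi\rangle\in\mathfrak{R}$; $\vDash\psi\looparrowright\chi$ iff ($\psi$ false or $\chi$ true) and $\langle\psi,\chi\rangle\in\mathfrak{R}$. $\mathsf{Th}(\mathfrak{M})=\{\varphi:\mathfrak{M}\vDash\varphi\}$. Define $\mathfrak{R}^{\mathsf{Th}(\mathfrak{M})}_{\mathsf{min}}=\{\langle\varphi,\psi\rangle:\varphi\looparrowright\psi\in\mathsf{Th}(\mathfrak{M})\}$, $\mathfrak{R}^{\mathsf{Th}(\mathfrak{M})}_{\mathsf{max}}=\{\langle\varphi,\psi\rangle:\varphi\looparrowright\psi\in\mathsf{Th}(\mathfrak{M})\text{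 or }\varphi\to\psi\notin\mathsf{Th}(\mathfrak{M})\}$, $v^{\mathsf{Th}(\mathfrak{M})}(p)=1$ iff $p\in\mathsf{Th}(\mathfrak{M})$ for $p\in\Phi$, and $\mathsf{S}^{\mathsf{Th}(\mathfrak{M})}=\{\langle v',\mathfrak{R}'\rangle: v'=v^{\mathsf{Th}(\mathfrak{M})},\ \mathfrak{R}^{\mathsf{Th}(\mathfrak{M})}_{\mathsf{min}}\subseteq\mathfrak{R}'\subseteq\mathfrak{R}^{\mathsf{Th}(\mathfrak{M})}_{\mathsf{max}}\}$. -}

module Defs where

open import Data.Nat using (ℕ)
open import Data.Bool using (Bool; true; false; not; _∧_; _∨_)
open import Data.Product using (_×_; Σ)
open import Data.Sum using (_⊎_)
open import Relation.Binary.PropositionalEquality using (_≡_)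
open import Relation.Nullary using (¬_)
open import Function.Bundles using (_⇔_)

data Formula : Set where
  var  : ℕ → Formula
  ¬'_  : Formula → Formula
  _∨'_ _∧'_ _⇒'_ _⇔'_ _△_ _↬_ : Formula → Formula → Formula

-- Epstein model ⟨v, ℜ⟩ ; ℜ ⊆ FOR² given by its characteristic function
record Model : Set where
  constructor ⟨_,_⟩
  field
    val : ℕ → Bool
    rel : Formula → Formula → Bool
open Model public

_⇒ᵇ_ : Bool → Bool → Bool
a ⇒ᵇ b = not a ∨ b

_⇔ᵇ_ : Bool → Bool → Bool
true  ⇔ᵇ b = b
false ⇔ᵇ b = not b

⟦_⟧ : Formula → Model → Bool
⟦ var p ⟧ M = val M p
⟦ ¬' φ ⟧ M = not (⟦ φ ⟧ M)
⟦ φ ∨' ψ ⟧ M = ⟦ φ ⟧ M ∨ ⟦ ψ ⟧ M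
⟦ φ ∧' ψ ⟧ M = ⟦ φ ⟧ M ∧ ⟦ ψ ⟧ M
⟦ φ ⇒' ψ ⟧ M = ⟦ φ ⟧ M ⇒ᵇ ⟦ ψ ⟧ M
⟦ φ ⇔' ψ ⟧ M = ⟦ φ ⟧ M ⇔ᵇ ⟦ ψ ⟧ M
⟦ φ △ ψ ⟧ M = (⟦ φ ⟧ M ∧ ⟦ ψ ⟧ M) ∧ rel M φ ψ
⟦ φ ↬ ψ ⟧ M = (⟦ φ ⟧ M ⇒ᵇ ⟦ ψ ⟧ M) ∧ rel M φ ψ

_⊨_ : Model → Formula → Set
M ⊨ φ = ⟦ φ ⟧ M ≡ true

Th : Model → Formula → Set
Th M φ = M ⊨ φ

SameTh : Model → Model → Set
SameTh M N = ∀ φ → (Th M φ ⇔ Th N φ)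

Rmin : Model → Formula → Formula → Set
Rmin M φ ψ = Th M (φ ↬ ψ)

Rmax : Model → Formula → Formula → Set
Rmax M φ ψ = Th M (φ ↬ ψ) ⊎ ¬ Th M (φ ⇒' ψ)

-- N ∈ S^{Th(M)} : v_N = v^{Th(M)} and ℜ_min ⊆ ℜ_N ⊆ ℜ_max
InS : Model → Model → Set
InS M N =
  (∀ p → (val N p ≡ true ⇔ Th M (var p)))
  × (∀ φ ψ → Rmin M φ ψ → rel N φ ψ ≡ true)
  × (∀ φ ψ → rel N φ ψ ≡ true → Rmax M φ ψ)

-- A formula's truth value consults ℜ only at pairs ⟨φ, ψ⟩ where φ → ψ holds
-- classically (for φ △ ψ and φ ↬ ψ the relation is irrelevant otherwise), and
-- ℜ_min ⊆ ℜ ⊆ ℜ_max pins ℜ down to ℜ_M on exactly those pairs. So every member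
-- of S^{Th(M)} evaluates all formulas as M does. Conversely, if Th(M) = Th(N)
-- then N's valuation and relation are read off from the letters and from the
-- formulas φ ↬ ψ and φ → ψ in Th(N) = Th(M).
module Submission where

open import Defs
open import Data.Bool using (true; false; not; _∧_; _∨_)
open import Data.Product using (_,_)
open import Data.Sum using (inj₁; inj₂)
open import Data.Empty using (⊥-elim)
open import Function.Bundles using (_⇔_; mk⇔; Equivalence)
open import Function.Properties.Equivalence using () renaming (sym to ⇔-sym)
open import Relation.Binary.PropositionalEquality using (_≡_; refl; sym; trans; cong; cong₂)

open Equivalence using (to; from)

≡-from-≡true⇔ : ∀ {a b} → (a ≡ true ⇔ b ≡ true) → a ≡ b
≡-from-≡true⇔ {true}  {true}  _ = refl
≡-from-≡true⇔ {false} {false} _ = refl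
≡-from-≡true⇔ {true}  {false} a⇔b = sym (to a⇔b refl)
≡-from-≡true⇔ {false} {true}  a⇔b = from a⇔b refl

∧-intro : ∀ {a b} → a ≡ true → b ≡ true → a ∧ b ≡ true
∧-intro refl refl = refl

∧-elimʳ : ∀ a {b} → a ∧ b ≡ true → b ≡ true
∧-elimʳ true b≡true = b≡true

∧⇒⇒ᵇ : ∀ a b → a ∧ b ≡ true → (a ⇒ᵇ b) ≡ true
∧⇒⇒ᵇ true true _ = refl

∧-congˡ-guarded : ∀ c {r s} → (c ≡ true → r ≡ s) → c ∧ r ≡ c ∧ s
∧-congˡ-guarded true  r≡s = r≡s refl
∧-congˡ-guarded false _   = refl

record Agree (M N : Model) : Set where
  field
    val-agree : ∀ p → val N p ≡ val M p
    rel-agree : ∀ φ ψ → M ⊨ (φ ⇒' ψ) → rel N φ ψ ≡ rel M φ ψ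

module _ {M N : Model} (agree : Agree M N) where
  open Agree agree

  agree⇒⟦⟧≡ : ∀ φ → ⟦ φ ⟧ N ≡ ⟦ φ ⟧ M
  agree⇒⟦⟧≡ (var p)  = val-agree p
  agree⇒⟦⟧≡ (¬' φ)   = cong not (agree⇒⟦⟧≡ φ)
  agree⇒⟦⟧≡ (φ ∨' ψ) = cong₂ _∨_ (agree⇒⟦⟧≡ φ) (agree⇒⟦⟧≡ ψ)
  agree⇒⟦⟧≡ (φ ∧' ψ) = cong₂ _∧_ (agree⇒⟦⟧≡ φ) (agree⇒⟦⟧≡ ψ)
  agree⇒⟦⟧≡ (φ ⇒' ψ) = cong₂ _⇒ᵇ_ (agree⇒⟦⟧≡ φ) (agree⇒⟦⟧≡ ψ)
  agree⇒⟦⟧≡ (φ ⇔' ψ) = cong₂ _⇔ᵇ_ (agree⇒⟦⟧≡ φ) (agree⇒⟦⟧≡ ψ)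
  agree⇒⟦⟧≡ (φ △ ψ) rewrite agree⇒⟦⟧≡ φ | agree⇒⟦⟧≡ ψ =
    ∧-congˡ-guarded (⟦ φ ⟧ M ∧ ⟦ ψ ⟧ M)
      (λ both → rel-agree φ ψ (∧⇒⇒ᵇ (⟦ φ ⟧ M) (⟦ ψ ⟧ M) both))
  agree⇒⟦⟧≡ (φ ↬ ψ) rewrite agree⇒⟦⟧≡ φ | agree⇒⟦⟧≡ ψ =
    ∧-congˡ-guarded (⟦ φ ⟧ M ⇒ᵇ ⟦ ψ ⟧ M) (rel-agree φ ψ)

  agree⇒sameTh : SameTh M N
  agree⇒sameTh φ = mk⇔ (trans (agree⇒⟦⟧≡ φ)) (trans (sym (agree⇒⟦⟧≡ φ)))

inS⇒agree : ∀ {M N} → InS M N → Agree M N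
inS⇒agree {M} {N} (val-in , min⊆rel , rel⊆max) = record
  { val-agree = λ p → ≡-from-≡true⇔ (val-in p)
  ; rel-agree = λ φ ψ φ⇒ψ →
      ≡-from-≡true⇔ (mk⇔ (rel⇒relM φ ψ φ⇒ψ) (λ r → min⊆rel φ ψ (∧-intro φ⇒ψ r)))
  }
  where
  rel⇒relM : ∀ φ ψ → M ⊨ (φ ⇒' ψ) → rel N φ ψ ≡ true → rel M φ ψ ≡ true
  rel⇒relM φ ψ φ⇒ψ r with rel⊆max φ ψ r
  ... | inj₁ M⊨φ↬ψ = ∧-elimʳ (⟦ φ ⟧ M ⇒ᵇ ⟦ ψ ⟧ M) M⊨φ↬ψ
  ... | inj₂ M⊭φ⇒ψ = ⊥-elim (M⊭φ⇒ψ φ⇒ψ)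

sameTh⇒inS : ∀ {M N} → SameTh M N → InS M N
sameTh⇒inS {M} {N} thM≈thN =
  (λ p → ⇔-sym (thM≈thN (var p)))
  , (λ φ ψ M⊨φ↬ψ → ∧-elimʳ (⟦ φ ⟧ N ⇒ᵇ ⟦ ψ ⟧ N) (to (thM≈thN (φ ↬ ψ)) M⊨φ↬ψ))
  , rel⊆max
  where
  rel⊆max : ∀ φ ψ → rel N φ ψ ≡ true → Rmax M φ ψ
  -- The with-abstraction also rewrites Rmax M φ ψ, whose ↬-part becomes
  -- true ∧ rel M φ ψ ≡ true in the second clause.
  rel⊆max φ ψ r with ⟦ φ ⟧ M ⇒ᵇ ⟦ ψ ⟧ M in φ⇒ψ
  ... | false = inj₂ λ ()
  ... | true  = inj₁ (∧-elimʳ (⟦ φ ⟧ M ⇒ᵇ ⟦ ψ ⟧ M) M⊨φ↬ψ)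
    where
    M⊨φ↬ψ : M ⊨ (φ ↬ ψ)
    M⊨φ↬ψ = from (thM≈thN (φ ↬ ψ)) (∧-intro (to (thM≈thN (φ ⇒' ψ)) φ⇒ψ) r)

mainTheorem17 : (M : Model) → (N : Model) → (InS M N ⇔ SameTh M N)
mainTheorem17 M N = mk⇔ (λ inS → agree⇒sameTh (inS⇒agree inS)) sameTh⇒inS
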